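{- Let $p$ be a prime, $n\ge1$, $R$ an $\mathbb{F}_p$-algebra and $\lambda\in R$. For $2\le s\le p^n-1$ put $E_s=Z_1^s+\sum_{k=2}^{s-1}\binom{s}{k}\lambda^kZ_1^{s-k}Z_{T^k}+\lambda^sZ_{T^s}$ in the polynomial ring $R[Z_1,Z_T,\dots,Z_{T^{p^n-1}}]$. Then $S(A^{(\lambda)}_R)_\Theta$ and $$R\Big[Z_1^{\pm1},Z_T,\dots,Z_{T^{p^n-1}},\frac{1}{Z_1+\lambda Z_T},\frac{1}{E_2},\dots,\frac{1}{E_{p^n-1}}\Big]$$ are isomorphic as $R$-algebras.
   Context: $S(A^{(\lambda)}_R)_\Theta=R[X_1,X_T,\dots,X_{T^{p^n-1}},1/\Delta]$ with $\Delta=\prod_{l=0}^{p^n-1}\big(\sum_{k=0}^l\binom{l}{k}\lambda^kX_{T^k}\big)$ ($X_{T^0}=X_1$) is the coordinate ring of the unit group scheme of the group algebra of $\varGamma^{(\lambda)}_R=\mathrm{Spec}\,R[T]/(T^{p^n})$, the group scheme with comultiplication $T\mapsto T\otimes1+1\otimes T+\lambda T\otimes T$. -}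

module Defs where

open import Level using (Level; _⊔_) renaming (suc to lsuc; zero to lzero)
open import Algebra.Bundles using (CommutativeRing)
open import Data.Nat as ℕ using (ℕ; zero; suc; _<?_; _∸_)
open import Data.Nat.Combinatorics using (_C_)
open import Data.Fin as Fin using (Fin; toℕ; fromℕ<; inject≤)
open import Data.Fin.Properties using (toℕ<n)
open import Data.Sum using (_⊎_; inj₁; inj₂)
open import Data.Unit using (⊤; tt)
open import Relation.Nullary using (yes; no)

module _ {c ℓ : Level} (R : CommutativeRing c ℓ) where
  open CommutativeRing R

  fromℕ : ℕ → Carrier
  fromℕ zero = 0#
  fromℕ (suc n) = 1# + fromℕ n

  pow : Carrier → ℕ → Carrier
  pow x zero = 1#
  pow x (suc k) = x * pow x k

  IsFpAlgebra : ℕ → Set ℓ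
  IsFpAlgebra p = fromℕ p ≈ 0#

  infixl 6 _⊕_
  infixl 7 _⊗_
  data Term (G : Set) : Set c where
    con : Carrier → Term G
    var : G → Term G
    _⊕_ : Term G → Term G → Term G
    _⊗_ : Term G → Term G → Term G
    ⊝_  : Term G → Term G

  record Presentation : Set (c ⊔ lsuc lzero) where
    field
      Gen : Set
      Idx : Set
      lhs : Idx → Term Gen
      rhs : Idx → Term Gen
  open Presentation public

  -- The congruence generated by the commutative R-algebra axioms and the relations;
  -- Term (Gen P) modulo Eqv P is the presented R-algebra R[Gen P]/(lhs i - rhs i).
  data Eqv (P : Presentation) : Term (Gen P) → Term (Gen P) → Set (c ⊔ ℓ) where
    ∼-refl  : ∀ {x} → Eqv P x x
    ∼-sym   : ∀ {x y} → Eqv P x y → Eqv P y x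
    ∼-trans : ∀ {x y z} → Eqv P x y → Eqv P y z → Eqv P x z
    ⊕-cong  : ∀ {x x′ y y′} → Eqv P x x′ → Eqv P y y′ → Eqv P (x ⊕ y) (x′ ⊕ y′)
    ⊗-cong  : ∀ {x x′ y y′} → Eqv P x x′ → Eqv P y y′ → Eqv P (x ⊗ y) (x′ ⊗ y′)
    ⊝-cong  : ∀ {x x′} → Eqv P x x′ → Eqv P (⊝ x) (⊝ x′)
    ⊕-assoc : ∀ x y z → Eqv P ((x ⊕ y) ⊕ z) (x ⊕ (y ⊕ z))
    ⊕-comm  : ∀ x y → Eqv P (x ⊕ y) (y ⊕ x)
    ⊕-idʳ   : ∀ x → Eqv P (x ⊕ con 0#) x
    ⊕-invʳ  : ∀ x → Eqv P (x ⊕ (⊝ x)) (con 0#)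
    ⊗-assoc : ∀ x y z → Eqv P ((x ⊗ y) ⊗ z) (x ⊗ (y ⊗ z))
    ⊗-comm  : ∀ x y → Eqv P (x ⊗ y) (y ⊗ x)
    ⊗-idʳ   : ∀ x → Eqv P (x ⊗ con 1#) x
    ⊗-distrib : ∀ x y z → Eqv P (x ⊗ (y ⊕ z)) ((x ⊗ y) ⊕ (x ⊗ z))
    con-cong : ∀ {a b} → a ≈ b → Eqv P (con a) (con b)
    con-+   : ∀ a b → Eqv P (con (a + b)) (con a ⊕ con b)
    con-*   : ∀ a b → Eqv P (con (a * b)) (con a ⊗ con b)
    rel     : ∀ i → Eqv P (lhs P i) (rhs P i)

  record IsAlgHom (P Q : Presentation) (f : Term (Gen P) → Term (Gen Q)) : Set (c ⊔ ℓ) where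
    field
      resp  : ∀ {x y} → Eqv P x y → Eqv Q (f x) (f y)
      hom-⊕ : ∀ x y → Eqv Q (f (x ⊕ y)) (f x ⊕ f y)
      hom-⊗ : ∀ x y → Eqv Q (f (x ⊗ y)) (f x ⊗ f y)
      hom-con : ∀ a → Eqv Q (f (con a)) (con a)

  record AlgIso (P Q : Presentation) : Set (c ⊔ ℓ) where
    field
      to     : Term (Gen P) → Term (Gen Q)
      from   : Term (Gen Q) → Term (Gen P)
      to-hom   : IsAlgHom P Q to
      from-hom : IsAlgHom Q P from
      from∘to : ∀ x → Eqv P (from (to x)) x
      to∘from : ∀ y → Eqv Q (to (from y)) y

  ΣT : ∀ {G} (m : ℕ) → (Fin m → Term G) → Term G
  ΣT zero f = con 0#
  ΣT (suc m) f = f Fin.zero ⊕ ΣT m (λ i → f (Fin.suc i))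

  ΠT : ∀ {G} (m : ℕ) → (Fin m → Term G) → Term G
  ΠT zero f = con 1#
  ΠT (suc m) f = f Fin.zero ⊗ ΠT m (λ i → f (Fin.suc i))

  powT : ∀ {G} → Term G → ℕ → Term G
  powT x zero = con 1#
  powT x (suc k) = x ⊗ powT x k

  -- the variable with index k (i.e. X_{T^k}) among N variables; only used for k < N
  varℕ : ∀ {G N} → (Fin N → G) → ℕ → Term G
  varℕ {N = N} v k with k <? N
  ... | yes k<N = var (v (fromℕ< k<N))
  ... | no  _   = con 0#

  module _ (λ′ : Carrier) (N : ℕ) where

    -- S(A^{(λ)}_R)_Θ = R[X_1, X_T, …, X_{T^{N-1}}, 1/Δ]  (N = p^n),
    -- presented as R[X_0..X_{N-1}, Y]/(Y·Δ - 1).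
    XGen : Set
    XGen = Fin N ⊎ ⊤

    X : ℕ → Term XGen
    X = varℕ inj₁

    Δ : Term XGen
    Δ = ΠT N (λ l → ΣT (suc (toℕ l)) (λ k →
          con (fromℕ (toℕ l C toℕ k) * pow λ′ (toℕ k)) ⊗ X (toℕ k)))

    SA-Θ : Presentation
    SA-Θ = record
      { Gen = XGen
      ; Idx = ⊤
      ; lhs = λ _ → var (inj₂ tt) ⊗ Δ
      ; rhs = λ _ → con 1#
      }

    -- R[Z_1^{±1}, Z_T, …, Z_{T^{N-1}}, 1/(Z_1+λZ_T), 1/E_2, …, 1/E_{N-1}],
    -- presented as R[Z_0..Z_{N-1}, W_0..W_{N-1}]/(W_s·F_s - 1),
    -- where F_0 = Z_1, F_1 = Z_1 + λ Z_T, F_s = E_s (2 ≤ s ≤ N-1).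
    ZGen : Set
    ZGen = Fin N ⊎ Fin N

    Z : ℕ → Term ZGen
    Z = varℕ inj₁

    E : ℕ → Term ZGen
    E s = (powT (Z 0) s
           ⊕ ΣT (s ∸ 2) (λ j → let k = 2 ℕ.+ toℕ j in
               con (fromℕ (s C k) * pow λ′ k) ⊗ powT (Z 0) (s ∸ k) ⊗ Z k))
          ⊕ con (pow λ′ s) ⊗ Z s

    F : ℕ → Term ZGen
    F zero = Z 0
    F (suc zero) = Z 0 ⊕ con λ′ ⊗ Z 1
    F s@(suc (suc _)) = E s

    LocZ : Presentation
    LocZ = record
      { Gen = ZGen
      ; Idx = Fin N
      ; lhs = λ s → var (inj₂ s) ⊗ F (toℕ s)
      ; rhs = λ _ → con 1#
      }

-- Index k stands for T^k, so Z₀, Z₁ are the paper's Z_1, Z_T. Let D_l = Σ_k C(l,k) λ^k X_k be the factors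
-- of Δ. With translate c g m = Σ_i C(m,i) c^(m-i) g_i and dilate a g j = a^j g_j one has
-- D_l = translate 1 (dilate λ X) l; translations compose additively, translating by 0 is the identity, and
-- a^m · translate c g m = translate (a c) (dilate a g) m. Put u = (Z₀ + λZ₁)/Z₀ and h = (1, 0, Z₂, Z₃, …).
-- The substitution
--   X_m = Z₀ · translate (Z₁/Z₀) (dilate (u/Z₀) h) m
-- gives D₀ = Z₀, D₁ = Z₀ + λZ₁ and D_s = Z₀ (u/Z₀)^s E_s for s ≥ 2, so it makes Δ invertible exactly when
-- Z₀, Z₀ + λZ₁ and the E_s are. It is undone by translating X/X₀ back by -X₁/X₀ and dilating by X₀/u,
-- which recovers h. The inverted generators (1/Δ on one side, the 1/F_s on the other) then correspond
-- automatically, as inverses are unique.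

module Submission where

open import Level using (Level; _⊔_)
open import Algebra.Bundles using (CommutativeRing)
open import Algebra.Structures using (IsCommutativeRing)
open import Algebra.Morphism.Structures using (module RingMorphisms)
import Algebra.Properties.Ring as RingProperties
open import Data.Nat as ℕ using (ℕ; zero; suc; _∸_; _≤_; _<_; z≤n; s≤s; _^_; _≥_)
import Data.Nat.Properties as ℕ
open import Data.Nat.Combinatorics using (_C_; nCk+nC[k+1]≡[n+1]C[k+1]; k>n⇒nCk≡0; nCn≡1)
open import Data.Nat.Primality using (Prime; prime⇒nonTrivial; prime⇒nonZero)
open import Data.Fin as Fin using (Fin; toℕ; fromℕ<)
import Data.Fin.Properties as Fin
open import Data.Product using (_,_)
open import Data.Sum using (inj₁; inj₂)
open import Data.Unit using (tt)
open import Data.Empty using (⊥-elim)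
open import Function using (_∘_)
open import Relation.Nullary using (yes; no)
open import Relation.Binary.PropositionalEquality as ≡ using (_≡_)
open import Defs

module RingAlgebra {k kℓ : Level} (K : CommutativeRing k kℓ) where
  open CommutativeRing K hiding (zero)
  open import Relation.Binary.Reasoning.Setoid setoid
  open import Algebra.Solver.Ring.NaturalCoefficients.Default commutativeSemiring
    using (solve; _:+_; _:*_; _:=_) renaming (con to κ)

  pow-cong : ∀ {a b} j → a ≈ b → pow K a j ≈ pow K b j
  pow-cong zero    a≈b = refl
  pow-cong (suc j) a≈b = *-cong a≈b (pow-cong j a≈b)

  pow-1# : ∀ j → pow K 1# j ≈ 1#
  pow-1# zero    = refl
  pow-1# (suc j) = trans (*-identityˡ _) (pow-1# j)

  pow-distrib-* : ∀ a b j → pow K a j * pow K b j ≈ pow K (a * b) j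
  pow-distrib-* a b zero    = *-identityˡ 1#
  pow-distrib-* a b (suc j) = trans
    (solve 4 (λ a b x y → (a :* x) :* (b :* y) := (a :* b) :* (x :* y)) refl a b (pow K a j) (pow K b j))
    (*-cong refl (pow-distrib-* a b j))

  pow-inverse : ∀ {a b} j → a * b ≈ 1# → pow K a j * pow K b j ≈ 1#
  pow-inverse {a} {b} j ab≈1 = trans (pow-distrib-* a b j) (trans (pow-cong j ab≈1) (pow-1# j))

  pow-cancel : ∀ j {a a′ b b′} t → a * a′ ≈ 1# → b * b′ ≈ 1# →
               pow K a j * (pow K b j * (pow K b′ j * (pow K a′ j * t))) ≈ t
  pow-cancel j {a} {a′} {b} {b′} t aa′≈1 bb′≈1 = begin
    pow K a j * (pow K b j * (pow K b′ j * (pow K a′ j * t)))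
      ≈⟨ solve 5 (λ a b b′ a′ t → a :* (b :* (b′ :* (a′ :* t))) := (a :* a′) :* ((b :* b′) :* t))
                 refl (pow K a j) (pow K b j) (pow K b′ j) (pow K a′ j) t ⟩
    (pow K a j * pow K a′ j) * ((pow K b j * pow K b′ j) * t)
      ≈⟨ *-cong (pow-inverse j aa′≈1) (*-cong (pow-inverse j bb′≈1) refl) ⟩
    1# * (1# * t)
      ≈⟨ trans (*-identityˡ _) (*-identityˡ t) ⟩
    t
      ∎

  fromℕ-+ : ∀ m n → fromℕ K (m ℕ.+ n) ≈ fromℕ K m + fromℕ K n
  fromℕ-+ zero    n = sym (+-identityˡ _)
  fromℕ-+ (suc m) n = trans (+-cong refl (fromℕ-+ m n)) (sym (+-assoc _ _ _))

  inverse-unique : ∀ {a x y} → x * a ≈ 1# → y * a ≈ 1# → x ≈ y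
  inverse-unique {a} {x} {y} xa≈1 ya≈1 = begin
    x             ≈⟨ sym (trans (*-cong refl ya≈1) (*-identityʳ x)) ⟩
    x * (y * a)   ≈⟨ solve 3 (λ x y a → x :* (y :* a) := y :* (x :* a)) refl x y a ⟩
    y * (x * a)   ≈⟨ trans (*-cong refl xa≈1) (*-identityʳ y) ⟩
    y             ∎

  Σ< : ℕ → (ℕ → Carrier) → Carrier
  Σ< zero    f = 0#
  Σ< (suc n) f = f 0 + Σ< n (f ∘ suc)

  Π< : ℕ → (ℕ → Carrier) → Carrier
  Π< zero    f = 1#
  Π< (suc n) f = f 0 * Π< n (f ∘ suc)

  Σ<-cong : ∀ n {f g} → (∀ i → i < n → f i ≈ g i) → Σ< n f ≈ Σ< n g
  Σ<-cong zero    f≈g = refl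
  Σ<-cong (suc n) f≈g = +-cong (f≈g 0 (s≤s z≤n)) (Σ<-cong n (λ i i<n → f≈g (suc i) (s≤s i<n)))

  Σ<-+ : ∀ n f g → Σ< n (λ i → f i + g i) ≈ Σ< n f + Σ< n g
  Σ<-+ zero    f g = sym (+-identityˡ _)
  Σ<-+ (suc n) f g = trans (+-cong refl (Σ<-+ n _ _))
    (solve 4 (λ a b x y → (a :+ b) :+ (x :+ y) := (a :+ x) :+ (b :+ y)) refl (f 0) (g 0) _ _)

  Σ<-*ˡ : ∀ n a f → Σ< n (λ i → a * f i) ≈ a * Σ< n f
  Σ<-*ˡ zero    a f = sym (zeroʳ a)
  Σ<-*ˡ (suc n) a f = trans (+-cong refl (Σ<-*ˡ n a _)) (sym (distribˡ _ _ _))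

  Σ<-last : ∀ n f → Σ< (suc n) f ≈ Σ< n f + f n
  Σ<-last zero    f = trans (+-identityʳ _) (sym (+-identityˡ _))
  Σ<-last (suc n) f = trans (+-cong refl (Σ<-last n _)) (sym (+-assoc _ _ _))

  Π<-cong : ∀ n {f g} → (∀ i → i < n → f i ≈ g i) → Π< n f ≈ Π< n g
  Π<-cong zero    f≈g = refl
  Π<-cong (suc n) f≈g = *-cong (f≈g 0 (s≤s z≤n)) (Π<-cong n (λ i i<n → f≈g (suc i) (s≤s i<n)))

  Π<-* : ∀ n f g → Π< n f * Π< n g ≈ Π< n (λ i → f i * g i)
  Π<-* zero    f g = *-identityˡ _
  Π<-* (suc n) f g = trans
    (solve 4 (λ a b x y → (a :* x) :* (b :* y) := (a :* b) :* (x :* y)) refl (f 0) (g 0) _ _)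
    (*-cong refl (Π<-* n _ _))

  Π<-1# : ∀ n f → (∀ i → i < n → f i ≈ 1#) → Π< n f ≈ 1#
  Π<-1# zero    f f≈1 = refl
  Π<-1# (suc n) f f≈1 = trans (Π<-cong (suc n) f≈1) (trans (*-identityˡ _) (Π<-1# n _ (λ _ _ → refl)))

  omit : ℕ → (ℕ → Carrier) → ℕ → Carrier
  omit zero    f zero    = 1#
  omit zero    f (suc i) = f (suc i)
  omit (suc l) f zero    = f zero
  omit (suc l) f (suc i) = omit l (f ∘ suc) i

  Π<-omit : ∀ n l f → l < n → Π< n f ≈ f l * Π< n (omit l f)
  Π<-omit (suc n) zero    f l<n       = *-cong refl (sym (*-identityˡ _))
  Π<-omit (suc n) (suc l) f (s≤s l<n) = trans (*-cong refl (Π<-omit n l (f ∘ suc) l<n))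
    (solve 3 (λ a b x → a :* (b :* x) := b :* (a :* x)) refl (f 0) (f (suc l)) _)

  factor-inverse : ∀ {y} n f l → y * Π< n f ≈ 1# → l < n → (y * Π< n (omit l f)) * f l ≈ 1#
  factor-inverse {y} n f l yΠ≈1 l<n = begin
    (y * Π< n (omit l f)) * f l   ≈⟨ solve 3 (λ y p a → (y :* p) :* a := y :* (a :* p)) refl y _ (f l) ⟩
    y * (f l * Π< n (omit l f))   ≈⟨ *-cong refl (sym (Π<-omit n l f l<n)) ⟩
    y * Π< n f                    ≈⟨ yΠ≈1 ⟩
    1#                            ∎

  dilate : Carrier → (ℕ → Carrier) → ℕ → Carrier
  dilate a g j = pow K a j * g j

  translate : Carrier → (ℕ → Carrier) → ℕ → Carrier
  translate c g zero    = g 0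
  translate c g (suc m) = c * translate c g m + translate c (g ∘ suc) m

  translate-cong : ∀ m {c c′ g g′} → c ≈ c′ → (∀ j → j ≤ m → g j ≈ g′ j) →
                   translate c g m ≈ translate c′ g′ m
  translate-cong zero    c≈c′ g≈g′ = g≈g′ 0 z≤n
  translate-cong (suc m) c≈c′ g≈g′ = +-cong
    (*-cong c≈c′ (translate-cong m c≈c′ (λ j j≤m → g≈g′ j (ℕ.m≤n⇒m≤1+n j≤m))))
    (translate-cong m c≈c′ (λ j j≤m → g≈g′ (suc j) (s≤s j≤m)))

  translate-+ : ∀ m c g h → translate c (λ j → g j + h j) m ≈ translate c g m + translate c h m
  translate-+ zero    c g h = refl
  translate-+ (suc m) c g h = trans (+-cong (*-cong refl (translate-+ m c g h)) (translate-+ m c _ _))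
    (solve 5 (λ c a b x y → c :* (a :+ b) :+ (x :+ y) := (c :* a :+ x) :+ (c :* b :+ y)) refl c _ _ _ _)

  translate-*ˡ : ∀ m c a g → translate c (λ j → a * g j) m ≈ a * translate c g m
  translate-*ˡ zero    c a g = refl
  translate-*ˡ (suc m) c a g = trans (+-cong (*-cong refl (translate-*ˡ m c a g)) (translate-*ˡ m c a _))
    (solve 4 (λ c a x y → c :* (a :* x) :+ a :* y := a :* (c :* x :+ y)) refl c a _ _)

  translate-0# : ∀ m g → translate 0# g m ≈ g m
  translate-0# zero    g = refl
  translate-0# (suc m) g = trans (+-cong (zeroˡ _) (translate-0# m _)) (+-identityˡ _)

  translate-translate : ∀ m c d g → translate c (translate d g) m ≈ translate (c + d) g m
  translate-translate zero    c d g = refl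
  translate-translate (suc m) c d g = begin
    c * translate c (translate d g) m + translate c (λ j → d * translate d g j + translate d (g ∘ suc) j) m
      ≈⟨ +-cong refl (translate-+ m c _ _) ⟩
    c * translate c (translate d g) m
      + (translate c (λ j → d * translate d g j) m + translate c (translate d (g ∘ suc)) m)
      ≈⟨ +-cong (*-cong refl (translate-translate m c d g))
                (+-cong (trans (translate-*ˡ m c d _) (*-cong refl (translate-translate m c d g)))
                        (translate-translate m c d _)) ⟩
    c * translate (c + d) g m + (d * translate (c + d) g m + translate (c + d) (g ∘ suc) m)
      ≈⟨ solve 4 (λ c d x y → c :* x :+ (d :* x :+ y) := (c :+ d) :* x :+ y) refl c d _ _ ⟩
    (c + d) * translate (c + d) g m + translate (c + d) (g ∘ suc) m
      ∎

  pow-*-translate : ∀ m a c g → pow K a m * translate c g m ≈ translate (a * c) (dilate a g) m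
  pow-*-translate zero    a c g = refl
  pow-*-translate (suc m) a c g = begin
    (a * pow K a m) * (c * translate c g m + translate c (g ∘ suc) m)
      ≈⟨ solve 5 (λ a c p x y → (a :* p) :* (c :* x :+ y) := (a :* c) :* (p :* x) :+ a :* (p :* y))
                 refl a c (pow K a m) _ _ ⟩
    (a * c) * (pow K a m * translate c g m) + a * (pow K a m * translate c (g ∘ suc) m)
      ≈⟨ +-cong (*-cong refl (pow-*-translate m a c g)) (*-cong refl (pow-*-translate m a c (g ∘ suc))) ⟩
    (a * c) * translate (a * c) (dilate a g) m + a * translate (a * c) (dilate a (g ∘ suc)) m
      ≈⟨ +-cong refl (sym (trans (translate-cong m refl (λ j _ → *-assoc _ _ _)) (translate-*ˡ m _ a _))) ⟩
    (a * c) * translate (a * c) (dilate a g) m + translate (a * c) (dilate a g ∘ suc) m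
      ∎

  Σ<-pascal : ∀ s (a : ℕ → Carrier) →
    Σ< (suc s) (λ i → fromℕ K (suc s C suc i) * a i) ≈
    Σ< (suc s) (λ i → fromℕ K (s C i) * a i) + Σ< (suc s) (λ i → fromℕ K (s C suc i) * a i)
  Σ<-pascal s a = trans (Σ<-cong (suc s) pascal)
    (Σ<-+ (suc s) (λ i → fromℕ K (s C i) * a i) (λ i → fromℕ K (s C suc i) * a i))
    where
    pascal : ∀ i → i < suc s →
             fromℕ K (suc s C suc i) * a i ≈ fromℕ K (s C i) * a i + fromℕ K (s C suc i) * a i
    pascal i _ = begin
      fromℕ K (suc s C suc i) * a i
        ≈⟨ *-cong (reflexive (≡.cong (fromℕ K) (≡.sym (nCk+nC[k+1]≡[n+1]C[k+1] s i)))) refl ⟩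
      fromℕ K (s C i ℕ.+ s C suc i) * a i
        ≈⟨ trans (*-cong (fromℕ-+ (s C i) (s C suc i)) refl) (distribʳ _ _ _) ⟩
      fromℕ K (s C i) * a i + fromℕ K (s C suc i) * a i
        ∎

  binomialSum : ℕ → Carrier → (ℕ → Carrier) → Carrier
  binomialSum s c g = Σ< (suc s) (λ i → fromℕ K (s C i) * (pow K c (s ∸ i) * g i))

  binomialSum-upper : ∀ s c (g : ℕ → Carrier) →
    Σ< (suc s) (λ i → fromℕ K (s C suc i) * (pow K c (s ∸ i) * g (suc i))) ≈
    c * Σ< s (λ i → fromℕ K (s C suc i) * (pow K c (s ∸ suc i) * g (suc i)))
  binomialSum-upper s c g = begin
    Σ< (suc s) term
      ≈⟨ Σ<-last s term ⟩
    Σ< s term + term s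
      ≈⟨ +-cong (Σ<-cong s lower) top-vanishes ⟩
    Σ< s (λ i → c * (fromℕ K (s C suc i) * (pow K c (s ∸ suc i) * g (suc i)))) + 0#
      ≈⟨ trans (+-identityʳ _) (Σ<-*ˡ s c _) ⟩
    c * Σ< s (λ i → fromℕ K (s C suc i) * (pow K c (s ∸ suc i) * g (suc i)))
      ∎
    where
    term : ℕ → Carrier
    term i = fromℕ K (s C suc i) * (pow K c (s ∸ i) * g (suc i))
    lower : ∀ i → i < s → term i ≈ c * (fromℕ K (s C suc i) * (pow K c (s ∸ suc i) * g (suc i)))
    lower i i<s = trans (*-cong refl (*-cong (reflexive (≡.cong (pow K c) (ℕ.+-∸-assoc 1 i<s))) refl))
      (solve 4 (λ a c p x → a :* ((c :* p) :* x) := c :* (a :* (p :* x))) refl _ c _ _)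
    top-vanishes : term s ≈ 0#
    top-vanishes = trans (*-cong (reflexive (≡.cong (fromℕ K) (k>n⇒nCk≡0 (ℕ.n<1+n s)))) refl) (zeroˡ _)

  translate-binomial : ∀ s c g → binomialSum s c g ≈ translate c g s
  translate-binomial zero    c g = solve 1 (λ x → (κ 1 :+ κ 0) :* (κ 1 :* x) :+ κ 0 := x) refl (g 0)
  translate-binomial (suc s) c g = begin
    head + Σ< (suc s) (λ i → fromℕ K (suc s C suc i) * (pow K c (s ∸ i) * g (suc i)))
      ≈⟨ +-cong refl (Σ<-pascal s (λ i → pow K c (s ∸ i) * g (suc i))) ⟩
    head + (binomialSum s c (g ∘ suc) + Σ< (suc s) (λ i → fromℕ K (s C suc i) * (pow K c (s ∸ i) * g (suc i))))
      ≈⟨ +-cong refl (+-cong (translate-binomial s c (g ∘ suc)) (binomialSum-upper s c g)) ⟩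
    head + (translate c (g ∘ suc) s + c * upper)
      ≈⟨ solve 5 (λ c p g₀ x y → (κ 1 :+ κ 0) :* ((c :* p) :* g₀) :+ (y :+ c :* x)
                                 := c :* ((κ 1 :+ κ 0) :* (p :* g₀) :+ x) :+ y)
                 refl c (pow K c s) (g 0) upper _ ⟩
    c * binomialSum s c g + translate c (g ∘ suc) s
      ≈⟨ +-cong (*-cong refl (translate-binomial s c g)) refl ⟩
    c * translate c g s + translate c (g ∘ suc) s
      ∎
    where
    head = fromℕ K 1 * (pow K c (suc s) * g 0)
    upper = Σ< s (λ i → fromℕ K (s C suc i) * (pow K c (s ∸ suc i) * g (suc i)))

  normalised : (ℕ → Carrier) → ℕ → Carrier
  normalised z zero          = 1#
  normalised z (suc zero)    = 0#
  normalised z (suc (suc k)) = z (suc (suc k))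

  normalised-cong : ∀ {z z′} j → z j ≈ z′ j → normalised z j ≈ normalised z′ j
  normalised-cong zero          _    = refl
  normalised-cong (suc zero)    _    = refl
  normalised-cong (suc (suc j)) z≈z′ = z≈z′

  -- w₀ and v stand for x₀⁻¹ and the inverse of ratio (x 0) w₀ (x 1), see xs-hs
  hs : (ℕ → Carrier) → Carrier → Carrier → ℕ → Carrier
  hs x w₀ v j = pow K (x 0) j * (pow K v j * translate (- (x 1 * w₀)) (λ k → w₀ * x k) j)

  hs-cong : ∀ {x x′ w₀ w₀′ v v′} j → (∀ k → k ≤ j → x k ≈ x′ k) → x 1 ≈ x′ 1 →
            w₀ ≈ w₀′ → v ≈ v′ → hs x w₀ v j ≈ hs x′ w₀′ v′ j
  hs-cong j x≈ x₁≈ w₀≈ v≈ = *-cong (pow-cong j (x≈ 0 z≤n)) (*-cong (pow-cong j v≈)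
    (translate-cong j (-‿cong (*-cong x₁≈ w₀≈)) (λ k k≤j → *-cong w₀≈ (x≈ k k≤j))))

  hs-0 : ∀ x {w₀} v → x 0 * w₀ ≈ 1# → hs x w₀ v 0 ≈ 1#
  hs-0 x v x₀w₀≈1 = trans (*-identityˡ _) (trans (*-identityˡ _) (trans (*-comm _ _) x₀w₀≈1))

  hs-1 : ∀ x {w₀} v → x 0 * w₀ ≈ 1# → hs x w₀ v 1 ≈ 0#
  hs-1 x {w₀} v x₀w₀≈1 = trans (*-cong refl (*-cong refl cancel)) (trans (*-cong refl (zeroʳ _)) (zeroʳ _))
    where
    cancel : - (x 1 * w₀) * (w₀ * x 0) + w₀ * x 1 ≈ 0#
    cancel = trans (+-cong (trans (*-cong refl (trans (*-comm _ _) x₀w₀≈1)) (*-identityʳ _)) (*-comm _ _))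
                   (-‿inverseˡ _)

  module CoordinateChange (λ′ : Carrier) where

    factor : (ℕ → Carrier) → ℕ → Carrier
    factor x l = translate 1# (dilate λ′ x) l

    factor-cong : ∀ {x x′} l → (∀ j → j ≤ l → x j ≈ x′ j) → factor x l ≈ factor x′ l
    factor-cong l x≈x′ = translate-cong l refl (λ j j≤l → *-cong refl (x≈x′ j j≤l))

    factor-0 : ∀ x → factor x 0 ≈ x 0
    factor-0 x = *-identityˡ (x 0)

    factor-1 : ∀ x → factor x 1 ≈ x 0 + λ′ * x 1
    factor-1 x =
      solve 3 (λ x₀ x₁ l → κ 1 :* (κ 1 :* x₀) :+ (l :* κ 1) :* x₁ := x₀ :+ l :* x₁) refl (x 0) (x 1) λ′

    ratio : Carrier → Carrier → Carrier → Carrier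
    ratio z₀ w₀ z₁ = (z₀ + λ′ * z₁) * w₀

    ratio-inverse : ∀ {z₀ w₀ z₁ w₁} → z₀ * w₀ ≈ 1# → w₁ * (z₀ + λ′ * z₁) ≈ 1# →
                    ratio z₀ w₀ z₁ * (w₁ * z₀) ≈ 1#
    ratio-inverse {z₀} {w₀} {z₁} {w₁} z₀w₀≈1 w₁d≈1 = begin
      ((z₀ + λ′ * z₁) * w₀) * (w₁ * z₀)
        ≈⟨ solve 4 (λ d w₀ w₁ z₀ → (d :* w₀) :* (w₁ :* z₀) := (w₁ :* d) :* (z₀ :* w₀))
                   refl (z₀ + λ′ * z₁) w₀ w₁ z₀ ⟩
      (w₁ * (z₀ + λ′ * z₁)) * (z₀ * w₀)
        ≈⟨ trans (*-cong w₁d≈1 z₀w₀≈1) (*-identityˡ 1#) ⟩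
      1#
        ∎

    -- w₀ stands for z₀⁻¹; inverses are passed as arguments
    xs : Carrier → Carrier → Carrier → (ℕ → Carrier) → ℕ → Carrier
    xs z₀ w₀ z₁ h m = z₀ * translate (z₁ * w₀) (dilate (ratio z₀ w₀ z₁) (dilate w₀ h)) m

    xs-cong : ∀ {z₀ z₀′ w₀ w₀′ z₁ z₁′ h h′} m → z₀ ≈ z₀′ → w₀ ≈ w₀′ → z₁ ≈ z₁′ →
              (∀ j → j ≤ m → h j ≈ h′ j) → xs z₀ w₀ z₁ h m ≈ xs z₀′ w₀′ z₁′ h′ m
    xs-cong m z₀≈ w₀≈ z₁≈ h≈ = *-cong z₀≈ (translate-cong m (*-cong z₁≈ w₀≈) (λ j j≤m →
      *-cong (pow-cong j (*-cong (+-cong z₀≈ (*-cong refl z₁≈)) w₀≈))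
             (*-cong (pow-cong j w₀≈) (h≈ j j≤m))))

    factor-xs : ∀ {z₀ w₀} z₁ h → z₀ * w₀ ≈ 1# → ∀ s →
      factor (xs z₀ w₀ z₁ h) s ≈
      z₀ * (pow K (ratio z₀ w₀ z₁) s * (pow K w₀ s * translate z₀ (dilate λ′ h) s))
    factor-xs {z₀} {w₀} z₁ h z₀w₀≈1 s = begin
      translate 1# (dilate λ′ (xs z₀ w₀ z₁ h)) s
        ≈⟨ translate-cong s refl (λ j _ → dilate-xs j) ⟩
      translate 1# (λ j → z₀ * translate (λ′ * c) (dilate λ′ g) j) s
        ≈⟨ translate-*ˡ s 1# z₀ _ ⟩
      z₀ * translate 1# (translate (λ′ * c) (dilate λ′ g)) s
        ≈⟨ *-cong refl (translate-translate s 1# (λ′ * c) _) ⟩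
      z₀ * translate (1# + λ′ * c) (dilate λ′ g) s
        ≈⟨ *-cong refl (translate-cong s 1+λc≈u (λ j _ → reorder j)) ⟩
      z₀ * translate (u * 1#) (dilate u (dilate w₀ (dilate λ′ h))) s
        ≈⟨ *-cong refl (sym (pow-*-translate s u 1# _)) ⟩
      z₀ * (pow K u s * translate 1# (dilate w₀ (dilate λ′ h)) s)
        ≈⟨ *-cong refl (*-cong refl (translate-cong s (sym (trans (*-comm _ _) z₀w₀≈1)) (λ j _ → refl))) ⟩
      z₀ * (pow K u s * translate (w₀ * z₀) (dilate w₀ (dilate λ′ h)) s)
        ≈⟨ *-cong refl (*-cong refl (sym (pow-*-translate s w₀ z₀ _))) ⟩
      z₀ * (pow K u s * (pow K w₀ s * translate z₀ (dilate λ′ h) s))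
        ∎
      where
      c = z₁ * w₀
      u = ratio z₀ w₀ z₁
      g = dilate u (dilate w₀ h)
      dilate-xs : ∀ j → dilate λ′ (xs z₀ w₀ z₁ h) j ≈ z₀ * translate (λ′ * c) (dilate λ′ g) j
      dilate-xs j = trans (solve 3 (λ a b c → a :* (b :* c) := b :* (a :* c)) refl (pow K λ′ j) z₀ _)
                          (*-cong refl (pow-*-translate j λ′ c g))
      1+λc≈u : 1# + λ′ * c ≈ u * 1#
      1+λc≈u = sym (trans
        (solve 4 (λ z₀ w₀ z₁ l → (z₀ :+ l :* z₁) :* w₀ :* κ 1 := z₀ :* w₀ :+ l :* (z₁ :* w₀))
                 refl z₀ w₀ z₁ λ′)
        (+-cong z₀w₀≈1 refl))
      reorder : ∀ j → dilate λ′ g j ≈ dilate u (dilate w₀ (dilate λ′ h)) j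
      reorder j = solve 4 (λ a b c x → a :* (b :* (c :* x)) := b :* (c :* (a :* x))) refl
                          (pow K λ′ j) (pow K u j) (pow K w₀ j) (h j)

    xs-0 : ∀ z₀ w₀ z₁ h → h 0 ≈ 1# → xs z₀ w₀ z₁ h 0 ≈ z₀
    xs-0 z₀ w₀ z₁ h h₀≈1 =
      trans (*-cong refl (trans (*-identityˡ _) (trans (*-identityˡ _) h₀≈1))) (*-identityʳ _)

    xs-1 : ∀ {z₀ w₀} z₁ h → z₀ * w₀ ≈ 1# → h 0 ≈ 1# → h 1 ≈ 0# → xs z₀ w₀ z₁ h 1 ≈ z₁
    xs-1 {z₀} {w₀} z₁ h z₀w₀≈1 h₀≈1 h₁≈0 = begin
      z₀ * ((z₁ * w₀) * (1# * (1# * h 0)) + (ratio z₀ w₀ z₁ * 1#) * ((w₀ * 1#) * h 1))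
        ≈⟨ *-cong refl (+-cong (*-cong refl (trans (*-identityˡ _) (trans (*-identityˡ _) h₀≈1)))
                               (trans (*-cong refl (trans (*-cong refl h₁≈0) (zeroʳ _))) (zeroʳ _))) ⟩
      z₀ * ((z₁ * w₀) * 1# + 0#)
        ≈⟨ solve 3 (λ z₀ z₁ w₀ → z₀ :* (z₁ :* w₀ :* κ 1 :+ κ 0) := z₁ :* (z₀ :* w₀))
                   refl z₀ z₁ w₀ ⟩
      z₁ * (z₀ * w₀)
        ≈⟨ trans (*-cong refl z₀w₀≈1) (*-identityʳ _) ⟩
      z₁
        ∎

    xs-hs : ∀ x {w₀ v} → x 0 * w₀ ≈ 1# → ratio (x 0) w₀ (x 1) * v ≈ 1# →
            ∀ m {h} → (∀ j → j ≤ m → h j ≈ hs x w₀ v j) → xs (x 0) w₀ (x 1) h m ≈ x m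
    xs-hs x {w₀} {v} x₀w₀≈1 uv≈1 m {h} h≈ = begin
      x 0 * translate c (dilate u (dilate w₀ h)) m
        ≈⟨ *-cong refl (translate-cong m refl undilate) ⟩
      x 0 * translate c (translate (- c) xw) m
        ≈⟨ *-cong refl (translate-translate m c (- c) xw) ⟩
      x 0 * translate (c + - c) xw m
        ≈⟨ *-cong refl (trans (translate-cong m (-‿inverseʳ c) (λ _ _ → refl)) (translate-0# m xw)) ⟩
      x 0 * (w₀ * x m)
        ≈⟨ trans (sym (*-assoc _ _ _)) (trans (*-cong x₀w₀≈1 refl) (*-identityˡ _)) ⟩
      x m
        ∎
      where
      c = x 1 * w₀
      u = ratio (x 0) w₀ (x 1)
      xw = λ k → w₀ * x k
      undilate : ∀ j → j ≤ m → dilate u (dilate w₀ h) j ≈ translate (- c) xw j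
      undilate j j≤m = begin
        pow K u j * (pow K w₀ j * h j)
          ≈⟨ *-cong refl (*-cong refl (h≈ j j≤m)) ⟩
        pow K u j * (pow K w₀ j * (pow K (x 0) j * (pow K v j * translate (- c) xw j)))
          ≈⟨ pow-cancel j _ uv≈1 (trans (*-comm _ _) x₀w₀≈1) ⟩
        translate (- c) xw j
          ∎

    hs-xs : ∀ {z₀ w₀} z₁ {v h} → z₀ * w₀ ≈ 1# → ratio z₀ w₀ z₁ * v ≈ 1# →
            h 0 ≈ 1# → h 1 ≈ 0# → ∀ j → hs (xs z₀ w₀ z₁ h) w₀ v j ≈ h j
    hs-xs {z₀} {w₀} z₁ {v} {h} z₀w₀≈1 uv≈1 h₀≈1 h₁≈0 j = begin
      pow K (x 0) j * (pow K v j * translate (- (x 1 * w₀)) (λ k → w₀ * x k) j)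
        ≈⟨ *-cong (pow-cong j (xs-0 z₀ w₀ z₁ h h₀≈1))
                  (*-cong refl (translate-cong j (-‿cong (*-cong (xs-1 z₁ h z₀w₀≈1 h₀≈1 h₁≈0) refl))
                                                 (λ k _ → w₀*xs k))) ⟩
      pow K z₀ j * (pow K v j * translate (- c) (translate c g) j)
        ≈⟨ *-cong refl (*-cong refl (translate-translate j (- c) c g)) ⟩
      pow K z₀ j * (pow K v j * translate (- c + c) g j)
        ≈⟨ *-cong refl (*-cong refl (trans (translate-cong j (-‿inverseˡ c) (λ _ _ → refl))
                                           (translate-0# j g))) ⟩
      pow K z₀ j * (pow K v j * (pow K u j * (pow K w₀ j * h j)))
        ≈⟨ pow-cancel j (h j) z₀w₀≈1 (trans (*-comm _ _) uv≈1) ⟩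
      h j
        ∎
      where
      x = xs z₀ w₀ z₁ h
      c = z₁ * w₀
      u = ratio z₀ w₀ z₁
      g = dilate u (dilate w₀ h)
      w₀*xs : ∀ k → w₀ * x k ≈ translate c g k
      w₀*xs k = trans (sym (*-assoc _ _ _)) (trans (*-cong (trans (*-comm _ _) z₀w₀≈1) refl) (*-identityˡ _))

module RingHomomorphism {a aℓ b bℓ : Level} (K₁ : CommutativeRing a aℓ) (K₂ : CommutativeRing b bℓ)
  {φ : CommutativeRing.Carrier K₁ → CommutativeRing.Carrier K₂}
  (isHom : RingMorphisms.IsRingHomomorphism (CommutativeRing.rawRing K₁) (CommutativeRing.rawRing K₂) φ) where
  open CommutativeRing K₂ hiding (zero)
  open RingMorphisms.IsRingHomomorphism isHom using (+-homo; *-homo; -‿homo; 0#-homo; 1#-homo)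
  private
    module A = RingAlgebra K₁
    module B = RingAlgebra K₂

  fromℕ-homo : ∀ n → φ (fromℕ K₁ n) ≈ fromℕ K₂ n
  fromℕ-homo zero    = 0#-homo
  fromℕ-homo (suc n) = trans (+-homo _ _) (+-cong 1#-homo (fromℕ-homo n))

  pow-homo : ∀ x j → φ (pow K₁ x j) ≈ pow K₂ (φ x) j
  pow-homo x zero    = 1#-homo
  pow-homo x (suc j) = trans (*-homo _ _) (*-cong refl (pow-homo x j))

  dilate-homo : ∀ x g j → φ (A.dilate x g j) ≈ B.dilate (φ x) (φ ∘ g) j
  dilate-homo x g j = trans (*-homo _ _) (*-cong (pow-homo x j) refl)

  translate-homo : ∀ m c g → φ (A.translate c g m) ≈ B.translate (φ c) (φ ∘ g) m
  translate-homo zero    c g = refl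
  translate-homo (suc m) c g =
    trans (+-homo _ _) (+-cong (trans (*-homo _ _) (*-cong refl (translate-homo m c g)))
                               (translate-homo m c (g ∘ suc)))

  normalised-homo : ∀ z k → φ (A.normalised z k) ≈ B.normalised (φ ∘ z) k
  normalised-homo z zero          = 1#-homo
  normalised-homo z (suc zero)    = 0#-homo
  normalised-homo z (suc (suc k)) = refl

  xs-homo : ∀ λ′ z₀ w₀ z₁ h m →
    φ (A.CoordinateChange.xs λ′ z₀ w₀ z₁ h m) ≈
    B.CoordinateChange.xs (φ λ′) (φ z₀) (φ w₀) (φ z₁) (φ ∘ h) m
  xs-homo λ′ z₀ w₀ z₁ h m = trans (*-homo _ _) (*-cong refl (trans (translate-homo m _ _)
    (B.translate-cong m (*-homo _ _) (λ j _ → trans (dilate-homo u (A.dilate w₀ h) j)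
                                                      (*-cong (B.pow-cong j ratio-homo) (dilate-homo w₀ h j))))))
    where
    u = A.CoordinateChange.ratio λ′ z₀ w₀ z₁
    ratio-homo : φ u ≈ B.CoordinateChange.ratio (φ λ′) (φ z₀) (φ w₀) (φ z₁)
    ratio-homo = trans (*-homo _ _) (*-cong (trans (+-homo _ _) (+-cong refl (*-homo _ _))) refl)

  hs-homo : ∀ x w₀ v j → φ (A.hs x w₀ v j) ≈ B.hs (φ ∘ x) (φ w₀) (φ v) j
  hs-homo x w₀ v j = trans (*-homo _ _) (*-cong (pow-homo _ j) (trans (*-homo _ _) (*-cong (pow-homo _ j)
    (trans (translate-homo j _ _)
           (B.translate-cong j (trans (-‿homo _) (-‿cong (*-homo _ _))) (λ k _ → *-homo _ _))))))

module Presented {c ℓ : Level} (R : CommutativeRing c ℓ) where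
  private module R = CommutativeRing R
  open RingMorphisms using (IsRingHomomorphism)

  module _ (P : Presentation R) where
    private
      _∼_ = Eqv R P

      ⊕-idˡ : ∀ x → (con R.0# ⊕ x) ∼ x
      ⊕-idˡ x = ∼-trans (⊕-comm _ _) (⊕-idʳ x)

      ⊗-idˡ : ∀ x → (con R.1# ⊗ x) ∼ x
      ⊗-idˡ x = ∼-trans (⊗-comm _ _) (⊗-idʳ x)

      ⊕-invˡ : ∀ x → ((⊝ x) ⊕ x) ∼ con R.0#
      ⊕-invˡ x = ∼-trans (⊕-comm _ _) (⊕-invʳ x)

      ⊗-distribʳ : ∀ x y z → ((y ⊕ z) ⊗ x) ∼ ((y ⊗ x) ⊕ (z ⊗ x))
      ⊗-distribʳ x y z =
        ∼-trans (⊗-comm _ _) (∼-trans (⊗-distrib x y z) (⊕-cong (⊗-comm _ _) (⊗-comm _ _)))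

      isCommutativeRing : IsCommutativeRing _∼_ _⊕_ _⊗_ ⊝_ (con R.0#) (con R.1#)
      isCommutativeRing = record
        { isRing = record
          { +-isAbelianGroup = record
            { isGroup = record
              { isMonoid = record
                { isSemigroup = record
                  { isMagma = record
                    { isEquivalence = record { refl = ∼-refl ; sym = ∼-sym ; trans = ∼-trans }
                    ; ∙-cong = ⊕-cong }
                  ; assoc = ⊕-assoc }
                ; identity = ⊕-idˡ , ⊕-idʳ }
              ; inverse = ⊕-invˡ , ⊕-invʳ
              ; ⁻¹-cong = ⊝-cong }
            ; comm = ⊕-comm }
          ; *-cong = ⊗-cong
          ; *-assoc = ⊗-assoc
          ; *-identity = ⊗-idˡ , ⊗-idʳ
          ; distrib = ⊗-distrib , ⊗-distribʳ }
        ; *-comm = ⊗-comm }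

    presentedRing : CommutativeRing c (c ⊔ ℓ)
    presentedRing = record { isCommutativeRing = isCommutativeRing }

  substitute : ∀ {G H : Set} → (G → Term R H) → Term R G → Term R H
  substitute σ (con a) = con a
  substitute σ (var g) = σ g
  substitute σ (x ⊕ y) = substitute σ x ⊕ substitute σ y
  substitute σ (x ⊗ y) = substitute σ x ⊗ substitute σ y
  substitute σ (⊝ x)   = ⊝ substitute σ x

  substitute-var : ∀ {G : Set} (t : Term R G) → substitute var t ≡ t
  substitute-var (con a) = ≡.refl
  substitute-var (var g) = ≡.refl
  substitute-var (x ⊕ y) = ≡.cong₂ _⊕_ (substitute-var x) (substitute-var y)
  substitute-var (x ⊗ y) = ≡.cong₂ _⊗_ (substitute-var x) (substitute-var y)
  substitute-var (⊝ x)   = ≡.cong ⊝_ (substitute-var x)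

  substitute-substitute : ∀ {G H I : Set} (σ : G → Term R H) (τ : H → Term R I) t →
                          substitute τ (substitute σ t) ≡ substitute (substitute τ ∘ σ) t
  substitute-substitute σ τ (con a) = ≡.refl
  substitute-substitute σ τ (var g) = ≡.refl
  substitute-substitute σ τ (x ⊕ y) = ≡.cong₂ _⊕_ (substitute-substitute σ τ x) (substitute-substitute σ τ y)
  substitute-substitute σ τ (x ⊗ y) = ≡.cong₂ _⊗_ (substitute-substitute σ τ x) (substitute-substitute σ τ y)
  substitute-substitute σ τ (⊝ x)   = ≡.cong ⊝_ (substitute-substitute σ τ x)

  RespectsRelations : (P Q : Presentation R) → (Gen P → Term R (Gen Q)) → Set (c ⊔ ℓ)
  RespectsRelations P Q σ = ∀ i → Eqv R Q (substitute σ (lhs P i)) (substitute σ (rhs P i))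

  module _ {P Q : Presentation R} {σ : Gen P → Term R (Gen Q)} (σ-resp : RespectsRelations P Q σ) where

    substitute-resp : ∀ {x y} → Eqv R P x y → Eqv R Q (substitute σ x) (substitute σ y)
    substitute-resp ∼-refl          = ∼-refl
    substitute-resp (∼-sym e)       = ∼-sym (substitute-resp e)
    substitute-resp (∼-trans e e′)  = ∼-trans (substitute-resp e) (substitute-resp e′)
    substitute-resp (⊕-cong e e′)   = ⊕-cong (substitute-resp e) (substitute-resp e′)
    substitute-resp (⊗-cong e e′)   = ⊗-cong (substitute-resp e) (substitute-resp e′)
    substitute-resp (⊝-cong e)      = ⊝-cong (substitute-resp e)
    substitute-resp (⊕-assoc x y z) = ⊕-assoc _ _ _
    substitute-resp (⊕-comm x y)    = ⊕-comm _ _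
    substitute-resp (⊕-idʳ x)       = ⊕-idʳ _
    substitute-resp (⊕-invʳ x)      = ⊕-invʳ _
    substitute-resp (⊗-assoc x y z) = ⊗-assoc _ _ _
    substitute-resp (⊗-comm x y)    = ⊗-comm _ _
    substitute-resp (⊗-idʳ x)       = ⊗-idʳ _
    substitute-resp (⊗-distrib x y z) = ⊗-distrib _ _ _
    substitute-resp (con-cong e)    = con-cong e
    substitute-resp (con-+ a b)     = con-+ a b
    substitute-resp (con-* a b)     = con-* a b
    substitute-resp (rel i)         = σ-resp i

    substitute-isRingHomomorphism :
      IsRingHomomorphism (CommutativeRing.rawRing (presentedRing P)) (CommutativeRing.rawRing (presentedRing Q))
                         (substitute σ)
    substitute-isRingHomomorphism = record
      { isSemiringHomomorphism = record
        { isNearSemiringHomomorphism = record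
          { +-isMonoidHomomorphism = record
            { isMagmaHomomorphism = record
              { isRelHomomorphism = record { cong = substitute-resp }
              ; homo = λ _ _ → ∼-refl }
            ; ε-homo = ∼-refl }
          ; *-homo = λ _ _ → ∼-refl }
        ; 1#-homo = ∼-refl }
      ; -‿homo = λ _ → ∼-refl }

  module _ {P Q : Presentation R} (σ : Gen P → Term R (Gen Q)) (τ : Gen Q → Term R (Gen P))
           (τσ≈var : ∀ g → Eqv R P (substitute τ (σ g)) (var g)) where

    substitute-inverse : ∀ t → Eqv R P (substitute τ (substitute σ t)) t
    substitute-inverse (con a) = ∼-refl
    substitute-inverse (var g) = τσ≈var g
    substitute-inverse (x ⊕ y) = ⊕-cong (substitute-inverse x) (substitute-inverse y)
    substitute-inverse (x ⊗ y) = ⊗-cong (substitute-inverse x) (substitute-inverse y)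
    substitute-inverse (⊝ x)   = ⊝-cong (substitute-inverse x)

  substitutionIso : ∀ {P Q : Presentation R} (σ : Gen P → Term R (Gen Q)) (τ : Gen Q → Term R (Gen P)) →
    RespectsRelations P Q σ → RespectsRelations Q P τ →
    (∀ g → Eqv R P (substitute τ (σ g)) (var g)) → (∀ g → Eqv R Q (substitute σ (τ g)) (var g)) →
    AlgIso R P Q
  substitutionIso {P} {Q} σ τ σ-resp τ-resp τσ≈var στ≈var = record
    { to       = substitute σ
    ; from     = substitute τ
    ; to-hom   = record { resp = substitute-resp σ-resp
                        ; hom-⊕ = λ _ _ → ∼-refl ; hom-⊗ = λ _ _ → ∼-refl ; hom-con = λ _ → ∼-refl }
    ; from-hom = record { resp = substitute-resp τ-resp
                        ; hom-⊕ = λ _ _ → ∼-refl ; hom-⊗ = λ _ _ → ∼-refl ; hom-con = λ _ → ∼-refl }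
    ; from∘to  = substitute-inverse {P} {Q} σ τ τσ≈var
    ; to∘from  = substitute-inverse {Q} {P} τ σ στ≈var
    }

  varℕ-< : ∀ {G : Set} {n} (v : Fin n → G) k (k<n : k < n) → varℕ R v k ≡ var (v (fromℕ< k<n))
  varℕ-< {n = n} v k k<n with k ℕ.<? n
  ... | yes _   = ≡.refl
  ... | no  k≮n = ⊥-elim (k≮n k<n)

  substitute-varℕ : ∀ {G H : Set} {n} (ρ : G → Term R H) (v : Fin n → G) (f : ℕ → Term R H) →
                    (∀ i → ρ (v i) ≡ f (toℕ i)) → ∀ k → k < n → substitute ρ (varℕ R v k) ≡ f k
  substitute-varℕ ρ v f ρv≡f k k<n =
    ≡.trans (≡.cong (substitute ρ) (varℕ-< v k k<n))
            (≡.trans (ρv≡f (fromℕ< k<n)) (≡.cong f (Fin.toℕ-fromℕ< k<n)))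

  varℕ-toℕ : ∀ {G : Set} {n} (v : Fin n → G) i → varℕ R v (toℕ i) ≡ var (v i)
  varℕ-toℕ v i =
    ≡.trans (varℕ-< v (toℕ i) (Fin.toℕ<n i)) (≡.cong (var ∘ v) (Fin.fromℕ<-toℕ i (Fin.toℕ<n i)))

  module _ (Q : Presentation R) where
    open CommutativeRing (presentedRing Q) hiding (zero)
    open RingAlgebra (presentedRing Q)

    con-isRingHomomorphism : IsRingHomomorphism R.rawRing (CommutativeRing.rawRing (presentedRing Q)) con
    con-isRingHomomorphism = record
      { isSemiringHomomorphism = record
        { isNearSemiringHomomorphism = record
          { +-isMonoidHomomorphism = record
            { isMagmaHomomorphism = record
              { isRelHomomorphism = record { cong = con-cong }
              ; homo = con-+ }
            ; ε-homo = ∼-refl }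
          ; *-homo = con-* }
        ; 1#-homo = ∼-refl }
      ; -‿homo = λ a → RingProperties.+-inverseˡ-unique (CommutativeRing.ring (presentedRing Q))
                         (con (R.- a)) (con a) (trans (sym (con-+ _ _)) (con-cong (R.-‿inverseˡ a))) }

    module _ {G : Set} (σ : G → Term R (Gen Q)) where

      substitute-ΣT : ∀ m f (g : ℕ → Carrier) → (∀ i → substitute σ (f i) ≈ g (toℕ i)) →
                      substitute σ (ΣT R m f) ≈ Σ< m g
      substitute-ΣT zero    f g f≈g = refl
      substitute-ΣT (suc m) f g f≈g = +-cong (f≈g Fin.zero) (substitute-ΣT m _ _ (f≈g ∘ Fin.suc))

      substitute-ΠT : ∀ m f (g : ℕ → Carrier) → (∀ i → substitute σ (f i) ≈ g (toℕ i)) →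
                      substitute σ (ΠT R m f) ≈ Π< m g
      substitute-ΠT zero    f g f≈g = refl
      substitute-ΠT (suc m) f g f≈g = *-cong (f≈g Fin.zero) (substitute-ΠT m _ _ (f≈g ∘ Fin.suc))

      substitute-powT : ∀ x j → substitute σ (powT R x j) ≈ pow (presentedRing Q) (substitute σ x) j
      substitute-powT x zero    = refl
      substitute-powT x (suc j) = *-cong refl (substitute-powT x j)

module Localisations {c ℓ : Level} (R : CommutativeRing c ℓ) (λ′ : CommutativeRing.Carrier R) (N : ℕ) where
  private module R = CommutativeRing R
  open Presented R

  module _ (Q : Presentation R) where
    private A = presentedRing Q
    open CommutativeRing A hiding (zero)
    open RingAlgebra A
    open CoordinateChange (con λ′)
    open RingHomomorphism R A (con-isRingHomomorphism Q) using (fromℕ-homo; pow-homo)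
    open import Relation.Binary.Reasoning.Setoid setoid
    open import Algebra.Solver.Ring.NaturalCoefficients.Default commutativeSemiring
      using (solve; _:+_; _:*_; _:=_) renaming (con to κ)

    con-binomial : ∀ s k → con (fromℕ R (s C k) R.* pow R λ′ k) ≈ fromℕ A (s C k) * pow A (con λ′) k
    con-binomial s k = trans (con-* _ _) (*-cong (fromℕ-homo (s C k)) (pow-homo λ′ k))

    substitute-Δ : (σ : XGen R λ′ N → Term R (Gen Q)) →
                   substitute σ (Δ R λ′ N) ≈ Π< N (factor (substitute σ ∘ X R λ′ N))
    substitute-Δ σ = substitute-ΠT Q σ N _ (factor x) (λ l →
      trans (substitute-ΣT Q σ (suc (toℕ l)) (λ k → con (coefficient (toℕ l) (toℕ k)) ⊗ X R λ′ N (toℕ k))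
                           (summand (toℕ l)) (λ k → summand≈ (toℕ l) (toℕ k)))
            (translate-binomial (toℕ l) 1# (dilate (con λ′) x)))
      where
      x = substitute σ ∘ X R λ′ N
      coefficient : ℕ → ℕ → R.Carrier
      coefficient l k = fromℕ R (l C k) R.* pow R λ′ k
      summand : ℕ → ℕ → Carrier
      summand l k = fromℕ A (l C k) * (pow A 1# (l ∸ k) * dilate (con λ′) x k)
      summand≈ : ∀ l k → con (coefficient l k) ⊗ x k ≈ summand l k
      summand≈ l k = begin
        con (fromℕ R (l C k) R.* pow R λ′ k) ⊗ x k
          ≈⟨ *-cong (con-binomial l k) refl ⟩
        (fromℕ A (l C k) * pow A (con λ′) k) * x k
          ≈⟨ solve 3 (λ a b x → (a :* b) :* x := a :* (κ 1 :* (b :* x))) refl _ _ _ ⟩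
        fromℕ A (l C k) * (1# * dilate (con λ′) x k)
          ≈⟨ *-cong refl (*-cong (sym (pow-1# (l ∸ k))) refl) ⟩
        fromℕ A (l C k) * (pow A 1# (l ∸ k) * dilate (con λ′) x k)
          ∎

    substitute-E : (σ : ZGen R λ′ N → Term R (Gen Q)) (t : ℕ) →
      substitute σ (E R λ′ N (suc (suc t))) ≈
      translate (substitute σ (Z R λ′ N 0)) (dilate (con λ′) (normalised (substitute σ ∘ Z R λ′ N)))
                (suc (suc t))
    substitute-E σ t = begin
      (substitute σ (powT R (Z R λ′ N 0) s) + substitute σ (ΣT R t middle)) + con (pow R λ′ s) ⊗ z s
        ≈⟨ +-cong (+-cong (substitute-powT Q σ (Z R λ′ N 0) s)
                          (substitute-ΣT Q σ t middle (summand ∘ (2 ℕ.+_)) (middle≈ ∘ toℕ)))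
                  (*-cong (pow-homo λ′ s) refl) ⟩
      (pow A z₀ s + Σ< t (summand ∘ (2 ℕ.+_))) + pow A (con λ′) s * z s
        ≈⟨ +-cong (+-cong (sym first≈) refl) (sym last≈) ⟩
      (summand 0 + Σ< t (summand ∘ (2 ℕ.+_))) + summand s
        ≈⟨ solve 3 (λ a b c → (a :+ b) :+ c := a :+ (κ 0 :+ (b :+ c))) refl _ _ _ ⟩
      summand 0 + (0# + (Σ< t (summand ∘ (2 ℕ.+_)) + summand s))
        ≈⟨ +-cong refl (+-cong (sym second≈) (sym (Σ<-last t (summand ∘ (2 ℕ.+_))))) ⟩
      binomialSum s z₀ (dilate (con λ′) (normalised z))
        ≈⟨ translate-binomial s z₀ _ ⟩
      translate z₀ (dilate (con λ′) (normalised z)) s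
        ∎
      where
      s = suc (suc t)
      z = substitute σ ∘ Z R λ′ N
      z₀ = z 0
      middle : Fin t → Term R (ZGen R λ′ N)
      middle j = con (fromℕ R (s C (2 ℕ.+ toℕ j)) R.* pow R λ′ (2 ℕ.+ toℕ j))
                 ⊗ powT R (Z R λ′ N 0) (s ∸ (2 ℕ.+ toℕ j)) ⊗ Z R λ′ N (2 ℕ.+ toℕ j)
      summand : ℕ → Carrier
      summand i = fromℕ A (s C i) * (pow A z₀ (s ∸ i) * dilate (con λ′) (normalised z) i)
      middle≈ : ∀ j → substitute σ (con (fromℕ R (s C (2 ℕ.+ j)) R.* pow R λ′ (2 ℕ.+ j))
                                   ⊗ powT R (Z R λ′ N 0) (s ∸ (2 ℕ.+ j)) ⊗ Z R λ′ N (2 ℕ.+ j))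
                      ≈ summand (2 ℕ.+ j)
      middle≈ j = trans
        (*-cong (*-cong (con-binomial s (2 ℕ.+ j)) (substitute-powT Q σ (Z R λ′ N 0) (s ∸ (2 ℕ.+ j)))) refl)
        (solve 4 (λ a b c d → ((a :* b) :* c) :* d := a :* (c :* (b :* d))) refl _ _ _ _)
      first≈ : summand 0 ≈ pow A z₀ s
      first≈ = solve 1 (λ x → (κ 1 :+ κ 0) :* (x :* (κ 1 :* κ 1)) := x) refl _
      second≈ : summand 1 ≈ 0#
      second≈ = trans (*-cong refl (*-cong refl (zeroʳ _))) (trans (*-cong refl (zeroʳ _)) (zeroʳ _))
      last≈ : summand s ≈ pow A (con λ′) s * z s
      last≈ = begin
        fromℕ A (s C s) * (pow A z₀ (t ∸ t) * (pow A (con λ′) s * z s))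
          ≈⟨ *-cong (reflexive (≡.cong (fromℕ A) (nCn≡1 s)))
                    (*-cong (reflexive (≡.cong (pow A z₀) (ℕ.n∸n≡0 t))) refl) ⟩
        (1# + 0#) * (1# * (pow A (con λ′) s * z s))
          ≈⟨ solve 1 (λ x → (κ 1 :+ κ 0) :* (κ 1 :* x) := x) refl _ ⟩
        pow A (con λ′) s * z s
          ∎

module Isomorphism {c ℓ : Level} (R : CommutativeRing c ℓ) (λ′ : CommutativeRing.Carrier R) (M : ℕ) where
  open Presented R

  N : ℕ
  N = suc (suc M)

  0<N : 0 < N
  0<N = s≤s z≤n

  1<N : 1 < N
  1<N = s≤s (s≤s z≤n)

  open Localisations R λ′ N

  SA LZ : Presentation R
  SA = SA-Θ R λ′ N
  LZ = LocZ R λ′ N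

  module Forward where
    A = presentedRing LZ
    open CommutativeRing A hiding (zero)
    open RingAlgebra A
    open CoordinateChange (con λ′)
    open import Relation.Binary.Reasoning.Setoid setoid
    open import Algebra.Solver.Ring.NaturalCoefficients.Default commutativeSemiring
      using (solve; _:*_; _:=_)

    z w : ℕ → Carrier
    z = Z R λ′ N
    w = varℕ R inj₂

    w-inverse : ∀ s → s < N → w s * F R λ′ N s ≈ 1#
    w-inverse s s<N = ≡.subst (λ t → t ≈ 1#)
      (≡.cong₂ (λ a b → a ⊗ F R λ′ N b) (≡.sym (varℕ-< inj₂ s s<N)) (Fin.toℕ-fromℕ< s<N))
      (rel (fromℕ< s<N))

    z₀w₀≈1 : z 0 * w 0 ≈ 1#
    z₀w₀≈1 = trans (*-comm _ _) (w-inverse 0 0<N)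

    u⁻¹ : Carrier
    u⁻¹ = w 1 * z 0

    uu⁻¹≈1 : ratio (z 0) (w 0) (z 1) * u⁻¹ ≈ 1#
    uu⁻¹≈1 = ratio-inverse z₀w₀≈1 (w-inverse 1 1<N)

    E≈translate : ∀ t → E R λ′ N (suc (suc t)) ≈
                        translate (z 0) (dilate (con λ′) (normalised z)) (suc (suc t))
    E≈translate t = trans (reflexive (≡.sym (substitute-var _))) (trans (substitute-E LZ var t)
      (translate-cong (suc (suc t)) (reflexive (substitute-var _))
                      (λ j _ → *-cong refl (normalised-cong j (reflexive (substitute-var (z j)))))))

    x : ℕ → Carrier
    x = xs (z 0) (w 0) (z 1) (normalised z)

    x₀≈z₀ : x 0 ≈ z 0
    x₀≈z₀ = xs-0 (z 0) (w 0) (z 1) (normalised z) refl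

    x₁≈z₁ : x 1 ≈ z 1
    x₁≈z₁ = xs-1 (z 1) (normalised z) z₀w₀≈1 refl refl

    -- inverts D_s = z₀ uˢ w₀ˢ E_s (factor-xs)
    factorInverse : ℕ → Carrier
    factorInverse zero            = w 0
    factorInverse (suc zero)      = w 1
    factorInverse s@(suc (suc _)) = w 0 * (pow A u⁻¹ s * (pow A (z 0) s * w s))

    factorInverse-inverse : ∀ l → l < N → factorInverse l * factor x l ≈ 1#
    factorInverse-inverse zero _ =
      trans (*-cong refl (trans (factor-0 x) x₀≈z₀)) (trans (*-comm _ _) z₀w₀≈1)
    factorInverse-inverse (suc zero) _ =
      trans (*-cong refl (trans (factor-1 x) (+-cong x₀≈z₀ (*-cong refl x₁≈z₁)))) (w-inverse 1 1<N)
    factorInverse-inverse s@(suc (suc t)) s<N = begin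
      (w 0 * (pow A u⁻¹ s * (pow A (z 0) s * w s))) * factor x s
        ≈⟨ *-cong refl (trans (factor-xs (z 1) (normalised z) z₀w₀≈1 s)
                              (*-cong refl (*-cong refl (*-cong refl (sym (E≈translate t)))))) ⟩
      (w 0 * (pow A u⁻¹ s * (pow A (z 0) s * w s))) * (z 0 * (pow A u s * (pow A (w 0) s * E R λ′ N s)))
        ≈⟨ solve 8 (λ w₀ a b w z₀ u c e → (w₀ :* (a :* (b :* w))) :* (z₀ :* (u :* (c :* e)))
                                         := (z₀ :* w₀) :* (u :* (b :* (c :* (a :* (w :* e))))))
                   refl (w 0) (pow A u⁻¹ s) (pow A (z 0) s) (w s)
                        (z 0) (pow A u s) (pow A (w 0) s) (E R λ′ N s) ⟩
      (z 0 * w 0) * (pow A u s * (pow A (z 0) s * (pow A (w 0) s * (pow A u⁻¹ s * (w s * E R λ′ N s)))))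
        ≈⟨ *-cong z₀w₀≈1 (pow-cancel s _ uu⁻¹≈1 z₀w₀≈1) ⟩
      1# * (w s * E R λ′ N s)
        ≈⟨ trans (*-identityˡ _) (w-inverse s s<N) ⟩
      1#
        ∎
      where u = ratio (z 0) (w 0) (z 1)

    σ : XGen R λ′ N → Carrier
    σ (inj₁ i) = x (toℕ i)
    σ (inj₂ _) = Π< N factorInverse

    substitute-σ-X : ∀ k → k < N → substitute σ (X R λ′ N k) ≡ x k
    substitute-σ-X = substitute-varℕ σ inj₁ x (λ _ → ≡.refl)

    σ-resp : RespectsRelations SA LZ σ
    σ-resp tt = begin
      Π< N factorInverse * substitute σ (Δ R λ′ N)
        ≈⟨ *-cong refl (substitute-Δ LZ σ) ⟩
      Π< N factorInverse * Π< N (factor (substitute σ ∘ X R λ′ N))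
        ≈⟨ *-cong refl (Π<-cong N (λ l l<N → factor-cong l (λ j j≤l →
             reflexive (substitute-σ-X j (ℕ.≤-<-trans j≤l l<N))))) ⟩
      Π< N factorInverse * Π< N (factor x)
        ≈⟨ Π<-* N factorInverse (factor x) ⟩
      Π< N (λ l → factorInverse l * factor x l)
        ≈⟨ Π<-1# N _ factorInverse-inverse ⟩
      1#
        ∎

  module Backward where
    A = presentedRing SA
    open CommutativeRing A hiding (zero)
    open RingAlgebra A
    open CoordinateChange (con λ′)
    open import Relation.Binary.Reasoning.Setoid setoid
    open import Algebra.Solver.Ring.NaturalCoefficients.Default commutativeSemiring
      using (solve; _:*_; _:=_)

    x : ℕ → Carrier
    x = X R λ′ N

    y : Carrier
    y = var (inj₂ tt)

    yΔ≈1 : y * Δ R λ′ N ≈ 1#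
    yΔ≈1 = rel tt

    Δ≈Πfactor : Δ R λ′ N ≈ Π< N (factor x)
    Δ≈Πfactor = trans (reflexive (≡.sym (substitute-var _))) (trans (substitute-Δ SA var)
      (Π<-cong N (λ l _ → factor-cong l (λ j _ → reflexive (substitute-var (x j))))))

    factorInverse : ℕ → Carrier
    factorInverse l = y * Π< N (omit l (factor x))

    factorInverse-inverse : ∀ l → l < N → factorInverse l * factor x l ≈ 1#
    factorInverse-inverse l = factor-inverse N (factor x) l (trans (*-cong refl (sym Δ≈Πfactor)) yΔ≈1)

    w₀ w₁ u u⁻¹ : Carrier
    w₀ = factorInverse 0
    w₁ = factorInverse 1
    u = ratio (x 0) w₀ (x 1)
    u⁻¹ = w₁ * x 0

    x₀w₀≈1 : x 0 * w₀ ≈ 1#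
    x₀w₀≈1 = trans (*-comm _ _) (trans (*-cong refl (sym (factor-0 x))) (factorInverse-inverse 0 0<N))

    uu⁻¹≈1 : u * u⁻¹ ≈ 1#
    uu⁻¹≈1 = ratio-inverse x₀w₀≈1 (trans (*-cong refl (sym (factor-1 x))) (factorInverse-inverse 1 1<N))

    h : ℕ → Carrier
    h = hs x w₀ u⁻¹

    -- ŵ s inverts E_s(ẑ), since D_s = x₀ uˢ w₀ˢ E_s(ẑ) (factor≈E)
    ẑ ŵ : ℕ → Carrier
    ẑ zero            = x 0
    ẑ (suc zero)      = x 1
    ẑ s@(suc (suc _)) = h s
    ŵ zero            = w₀
    ŵ (suc zero)      = w₁
    ŵ s@(suc (suc _)) = x 0 * (pow A u s * (pow A w₀ s * factorInverse s))

    τ : ZGen R λ′ N → Carrier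
    τ (inj₁ i) = ẑ (toℕ i)
    τ (inj₂ i) = ŵ (toℕ i)

    substitute-τ-Z : ∀ k → k < N → substitute τ (Z R λ′ N k) ≡ ẑ k
    substitute-τ-Z = substitute-varℕ τ inj₁ ẑ (λ _ → ≡.refl)

    substitute-τ-w : ∀ k → k < N → substitute τ (varℕ R inj₂ k) ≡ ŵ k
    substitute-τ-w = substitute-varℕ τ inj₂ ŵ (λ _ → ≡.refl)

    h′ : ℕ → Carrier
    h′ = normalised (substitute τ ∘ Z R λ′ N)

    h′≈h : ∀ j → j < N → h′ j ≈ h j
    h′≈h zero          _   = sym (hs-0 x u⁻¹ x₀w₀≈1)
    h′≈h (suc zero)    _   = sym (hs-1 x u⁻¹ x₀w₀≈1)
    h′≈h (suc (suc j)) j<N = reflexive (substitute-τ-Z (suc (suc j)) j<N)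

    xs≈x : ∀ m → m < N → xs (x 0) w₀ (x 1) h′ m ≈ x m
    xs≈x m m<N = xs-hs x x₀w₀≈1 uu⁻¹≈1 m (λ j j≤m → h′≈h j (ℕ.≤-<-trans j≤m m<N))

    factor≈E : ∀ s → s < N →
               factor x s ≈ x 0 * (pow A u s * (pow A w₀ s * translate (x 0) (dilate (con λ′) h′) s))
    factor≈E s s<N = trans (factor-cong s (λ j j≤s → sym (xs≈x j (ℕ.≤-<-trans j≤s s<N))))
                           (factor-xs (x 1) h′ x₀w₀≈1 s)

    τ-resp : RespectsRelations LZ SA τ
    τ-resp Fin.zero = trans (*-cong refl (reflexive (substitute-τ-Z 0 0<N))) (trans (*-comm _ _) x₀w₀≈1)
    τ-resp (Fin.suc Fin.zero) = trans
      (*-cong refl (+-cong (reflexive (substitute-τ-Z 0 0<N)) (*-cong refl (reflexive (substitute-τ-Z 1 1<N)))))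
      (trans (*-cong refl (sym (factor-1 x))) (factorInverse-inverse 1 1<N))
    τ-resp i@(Fin.suc (Fin.suc j)) = begin
      ŵ s * substitute τ (E R λ′ N s)
        ≈⟨ *-cong refl (trans (substitute-E SA τ (toℕ j))
                              (translate-cong s (reflexive (substitute-τ-Z 0 0<N)) (λ _ _ → refl))) ⟩
      (x 0 * (pow A u s * (pow A w₀ s * factorInverse s))) * e
        ≈⟨ solve 5 (λ a b c d e → (a :* (b :* (c :* d))) :* e := d :* (a :* (b :* (c :* e))))
                   refl (x 0) (pow A u s) (pow A w₀ s) (factorInverse s) e ⟩
      factorInverse s * (x 0 * (pow A u s * (pow A w₀ s * e)))
        ≈⟨ *-cong refl (sym (factor≈E s s<N)) ⟩
      factorInverse s * factor x s
        ≈⟨ factorInverse-inverse s s<N ⟩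
      1#
        ∎
      where
      s = toℕ i
      s<N = Fin.toℕ<n i
      e = translate (x 0) (dilate (con λ′) h′) s

  open Forward using (σ; σ-resp)
  open Backward using (τ; τ-resp)

  module BackwardForward where
    open Backward
    open CommutativeRing A hiding (zero)
    open RingAlgebra A
    open CoordinateChange (con λ′)
    open RingHomomorphism (presentedRing LZ) A (substitute-isRingHomomorphism τ-resp)
      using (xs-homo; normalised-homo)
    open import Relation.Binary.Reasoning.Setoid setoid

    X-fixed : ∀ i → substitute τ (σ (inj₁ i)) ≈ var (inj₁ i)
    X-fixed i = begin
      substitute τ (Forward.x m)
        ≈⟨ xs-homo (con λ′) (Forward.z 0) (Forward.w 0) (Forward.z 1) hᴸ m ⟩
      xs (ẑ′ 0) (substitute τ (Forward.w 0)) (ẑ′ 1) (substitute τ ∘ hᴸ) m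
        ≈⟨ xs-cong m (reflexive (substitute-τ-Z 0 0<N)) (reflexive (substitute-τ-w 0 0<N))
                     (reflexive (substitute-τ-Z 1 1<N)) (λ j _ → normalised-homo Forward.z j) ⟩
      xs (x 0) w₀ (x 1) h′ m
        ≈⟨ xs≈x m (Fin.toℕ<n i) ⟩
      x m
        ≡⟨ varℕ-toℕ inj₁ i ⟩
      var (inj₁ i)
        ∎
      where
      m = toℕ i
      ẑ′ = substitute τ ∘ Forward.z
      hᴸ = RingAlgebra.normalised (presentedRing LZ) Forward.z

    ρ : XGen R λ′ N → Carrier
    ρ = substitute τ ∘ σ

    x-fixed : ∀ k → k < N → substitute ρ (x k) ≈ x k
    x-fixed k k<N = ≡.subst (λ t → substitute ρ t ≈ t) (≡.sym (varℕ-< inj₁ k k<N)) (X-fixed (fromℕ< k<N))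

    Δ-fixed : substitute τ (substitute σ (Δ R λ′ N)) ≈ Δ R λ′ N
    Δ-fixed = begin
      substitute τ (substitute σ (Δ R λ′ N))
        ≡⟨ substitute-substitute σ τ (Δ R λ′ N) ⟩
      substitute ρ (Δ R λ′ N)
        ≈⟨ substitute-Δ SA ρ ⟩
      Π< N (factor (substitute ρ ∘ x))
        ≈⟨ Π<-cong N (λ l l<N → factor-cong l (λ k k≤l → x-fixed k (ℕ.≤-<-trans k≤l l<N))) ⟩
      Π< N (factor x)
        ≈⟨ sym Δ≈Πfactor ⟩
      Δ R λ′ N
        ∎

    Y-fixed : substitute τ (σ (inj₂ tt)) ≈ y
    Y-fixed = inverse-unique
      (trans (*-cong refl (sym Δ-fixed))
             (substitute-resp {LZ} {SA} τ-resp (substitute-resp {SA} {LZ} σ-resp yΔ≈1)))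
      yΔ≈1

    τσ≈var : ∀ g → substitute τ (σ g) ≈ var g
    τσ≈var (inj₁ i)  = X-fixed i
    τσ≈var (inj₂ tt) = Y-fixed

  module ForwardBackward where
    open Forward
    open CommutativeRing A hiding (zero)
    open RingAlgebra A
    open CoordinateChange (con λ′)
    open RingHomomorphism (presentedRing SA) A (substitute-isRingHomomorphism σ-resp) using (hs-homo)
    open import Relation.Binary.Reasoning.Setoid setoid

    w-fixed : ∀ s → s < N → substitute σ (substitute τ (F R λ′ N s)) ≈ F R λ′ N s →
              substitute σ (substitute τ (w s)) ≈ w s
    w-fixed s s<N F-fixed = inverse-unique
      (trans (*-cong refl (sym F-fixed))
             (substitute-resp {SA} {LZ} σ-resp (substitute-resp {LZ} {SA} τ-resp (w-inverse s s<N))))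
      (w-inverse s s<N)

    σx₀≈z₀ : substitute σ (Backward.x 0) ≈ z 0
    σx₀≈z₀ = trans (reflexive (substitute-σ-X 0 0<N)) x₀≈z₀

    z₀-fixed : substitute σ (substitute τ (z 0)) ≈ z 0
    z₀-fixed = trans (reflexive (≡.cong (substitute σ) (Backward.substitute-τ-Z 0 0<N))) σx₀≈z₀

    z₁-fixed : substitute σ (substitute τ (z 1)) ≈ z 1
    z₁-fixed = trans (reflexive (≡.cong (substitute σ) (Backward.substitute-τ-Z 1 1<N)))
                     (trans (reflexive (substitute-σ-X 1 1<N)) x₁≈z₁)

    w₀-fixed : substitute σ Backward.w₀ ≈ w 0
    w₀-fixed = trans (reflexive (≡.cong (substitute σ) (≡.sym (Backward.substitute-τ-w 0 0<N))))
                     (w-fixed 0 0<N z₀-fixed)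

    w₁-fixed : substitute σ Backward.w₁ ≈ w 1
    w₁-fixed = trans (reflexive (≡.cong (substitute σ) (≡.sym (Backward.substitute-τ-w 1 1<N))))
                     (w-fixed 1 1<N (+-cong z₀-fixed (*-cong refl z₁-fixed)))

    z-fixed : ∀ k → k < N → substitute σ (substitute τ (z k)) ≈ z k
    z-fixed zero            _   = z₀-fixed
    z-fixed (suc zero)      _   = z₁-fixed
    z-fixed s@(suc (suc _)) s<N = begin
      substitute σ (substitute τ (z s))
        ≡⟨ ≡.cong (substitute σ) (Backward.substitute-τ-Z s s<N) ⟩
      substitute σ (Backward.h s)
        ≈⟨ hs-homo Backward.x Backward.w₀ Backward.u⁻¹ s ⟩
      hs (substitute σ ∘ Backward.x) (substitute σ Backward.w₀) (substitute σ Backward.u⁻¹) s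
        ≈⟨ hs-cong s (λ k k≤s → reflexive (substitute-σ-X k (ℕ.≤-<-trans k≤s s<N)))
                     (reflexive (substitute-σ-X 1 1<N)) w₀-fixed (*-cong w₁-fixed σx₀≈z₀) ⟩
      hs x (w 0) u⁻¹ s
        ≈⟨ hs-xs (z 1) z₀w₀≈1 uu⁻¹≈1 refl refl s ⟩
      z s
        ∎

    ρ : ZGen R λ′ N → Carrier
    ρ = substitute σ ∘ τ

    z-fixed′ : ∀ k → k < N → substitute ρ (z k) ≈ z k
    z-fixed′ k k<N = trans (reflexive (≡.sym (substitute-substitute τ σ (z k)))) (z-fixed k k<N)

    F-fixed : ∀ s → s < N → substitute σ (substitute τ (F R λ′ N s)) ≈ F R λ′ N s
    F-fixed zero            _   = z₀-fixed
    F-fixed (suc zero)      _   = +-cong z₀-fixed (*-cong refl z₁-fixed)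
    F-fixed s@(suc (suc t)) s<N = begin
      substitute σ (substitute τ (E R λ′ N s))
        ≡⟨ substitute-substitute τ σ (E R λ′ N s) ⟩
      substitute ρ (E R λ′ N s)
        ≈⟨ substitute-E LZ ρ t ⟩
      translate (substitute ρ (z 0)) (dilate (con λ′) (normalised (substitute ρ ∘ z))) s
        ≈⟨ translate-cong s (z-fixed′ 0 0<N) (λ j j≤s →
             *-cong refl (normalised-cong j (z-fixed′ j (ℕ.≤-<-trans j≤s s<N)))) ⟩
      translate (z 0) (dilate (con λ′) (normalised z)) s
        ≈⟨ sym (E≈translate t) ⟩
      E R λ′ N s
        ∎

    στ≈var : ∀ g → substitute σ (τ g) ≈ var g
    στ≈var (inj₁ i) = ≡.subst (λ t → substitute σ (substitute τ t) ≈ t) (varℕ-toℕ inj₁ i)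
                             (z-fixed (toℕ i) (Fin.toℕ<n i))
    στ≈var (inj₂ i) = ≡.subst (λ t → substitute σ (substitute τ t) ≈ t) (varℕ-toℕ inj₂ i)
                             (w-fixed (toℕ i) (Fin.toℕ<n i) (F-fixed (toℕ i) (Fin.toℕ<n i)))

  iso : AlgIso R SA LZ
  iso = substitutionIso σ τ σ-resp τ-resp BackwardForward.τσ≈var ForwardBackward.στ≈var

-- The change of variables uses the generators of index 1, hence N ≥ 2.
algIso : ∀ {c ℓ : Level} (R : CommutativeRing c ℓ) (λ′ : CommutativeRing.Carrier R) N → 2 ≤ N →
         AlgIso R (SA-Θ R λ′ N) (LocZ R λ′ N)
algIso R λ′ (suc (suc M)) (s≤s (s≤s _)) = Isomorphism.iso R λ′ M

prime^n≥2 : ∀ {p} n → Prime p → n ≥ 1 → 2 ≤ p ^ n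
prime^n≥2 {p} (suc n) p-prime _ =
  ℕ.*-mono-≤ (ℕ.nonTrivial⇒n>1 p {{prime⇒nonTrivial p-prime}}) (ℕ.m^n>0 p {{prime⇒nonZero p-prime}} n)

proposition3p6 : ∀ {c ℓ : Level} (p n : ℕ) → Prime p → n ≥ 1 →
    (R : CommutativeRing c ℓ) → IsFpAlgebra R p →
    (λ′ : CommutativeRing.Carrier R) →
    AlgIso R (SA-Θ R λ′ (p ^ n)) (LocZ R λ′ (p ^ n))
proposition3p6 p n p-prime n≥1 R _ λ′ = algIso R λ′ (p ^ n) (prime^n≥2 n p-prime n≥1)
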